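{- Let $F$ be a clause set. If $F$ is satisfiable, then the reasoning algorithm with inference rules $\mathrm{A1}^+$, $\mathrm{A2}^+$, and A3, started from $\mathcal{S}_0=\{F\}$, yields a complete and clash-free family of clause sets (i.e. some sequence of rule applications from $\mathcal{S}_0$ ends in a complete and clash-free family).
   Context: $\mathcal{ALC}$ interpretations $\mathcal{I}=(\Delta^\mathcal{I},\cdot^\mathcal{I})$ with the standard semantics of $\lnot,\sqcap,\sqcup,\forall R.,\exists R.$. Conjunctive normal forms are defined by mutual induction: a concept literal is $A$, $\lnot A$ ($A$ a concept name), $\exists R.F$ or $\forall R.F$ ($R$ a role name, $F$ a conjunctive normal form); a clause is a finite disjunction of concept literals, represented as a set of literals; a conjunctive normal form is a finite conjunction of clauses, represented as a clause set. A clause set denotes the conjunction of its clauses, each clause the disjunction of its literals; $F$ is satisfiable if $F^\mathcal{I}\neq\emptyset$ for some $\mathcal{I}$. The complementary literal $\overline{L}$ is: $\overline{A}=\lnot A$, $\overline{\lnot A}=A$, $\overline{\exists R.F}=\forall R.\mathrm{CNF}(\lnot F)$, $\overline{\forall R.F}=\exists R.\mathrm{CNF}(\lnot F)$, with $\mathrm{CNF}(C)$ the equivalent conjunctive normal form of $C$ (push negations inward, distribute $\sqcup$ over $\sqcap$, flatten). A derivation works on families of clause sets $\mathcal{S}_i$, starting with $\mathcal{S}_0=\{F\}$; $\mathcal{S}_{i+1}$ is obtained from $\mathcal{S}_i$ by applying one of the following rules to a clause set $F\in\mathcal{S}_i$: ($\mathrm{A1}^+$) if $L\in CL$ for a clause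 $CL\in F$ (nondeterministic choice of $L$): replace every clause $CL'\in F$ with $L\in CL'$ by $\{L\}$, and every clause $CL'\in F$ with $\overline{L}\in CL'$ by $CL'\setminus\{\overline{L}\}$. ($\mathrm{A2}^+$) if all clauses of $F$ are unit clauses and $\forall R.F_1\in CL$ for some $CL\in F$: remove from $F$ all clauses containing $\forall R.F_1$, and replace every literal $\exists R.F_2$ occurring in clauses of $F$ by $\exists R.(F_1\cup F_2)$. (A3) if all clauses of $F$ are unit clauses of the form $\{A\}$, $\{\lnot A\}$ or $\{\exists R.F'\}$: for some $\{\exists R.F_1\}\in F$, replace $F$ by $F\setminus\{\{\exists R.F_1\}\}$ and add $F_1$ to the family ($F$ is the parent of $F_1$ with respect to $R$). A family is complete if no rule is applicable to it. It is clash-free if no clause set in it contains the empty clause or contains both $\{L\}$ and $\{\overline{L}\}$ for some literal $L$. -}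

module Defs where

open import Data.Nat using (ℕ; _≟_)
open import Data.List using (List; []; _∷_; map; _++_)
open import Data.List.Membership.Propositional using (_∈_)
open import Data.List.Relation.Binary.Pointwise using (Pointwise)
open import Data.List.Relation.Unary.All using (All)
open import Data.Product using (Σ; ∃; _×_; _,_)
open import Data.Sum using (_⊎_)
open import Data.Empty using (⊥)
open import Data.Unit using (⊤)
open import Relation.Nullary using (¬_; yes; no)
open import Relation.Binary.PropositionalEquality using (_≡_)
open import Relation.Binary.Construct.Closure.ReflexiveTransitive using (Star)

-- A clause is a finite set of literals (represented by a list),
-- a clause set (conjunctive normal form) is a finite set of clauses
-- (represented by a list).  Sets are taken up to the extensional
-- equality defined below.

ConceptName : Set
ConceptName = ℕ

RoleName : Set
RoleName = ℕ

data Lit : Set where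
  pos : ConceptName → Lit
  neg : ConceptName → Lit
  exs : RoleName → List (List Lit) → Lit
  all : RoleName → List (List Lit) → Lit

Clause : Set
Clause = List Lit

ClauseSet : Set
ClauseSet = List Clause

record Interpretation : Set₁ where
  field
    Δ    : Set
    conc : ConceptName → Δ → Set
    role : RoleName → Δ → Δ → Set

module _ (I : Interpretation) where
  open Interpretation I

  mutual
    ⟦_⟧L : Lit → Δ → Set
    ⟦ pos A ⟧L d = conc A d
    ⟦ neg A ⟧L d = ¬ conc A d
    ⟦ exs R F ⟧L d = Σ Δ λ e → role R d e × ⟦ F ⟧S e
    ⟦ all R F ⟧L d = (e : Δ) → role R d e → ⟦ F ⟧S e

    ⟦_⟧C : Clause → Δ → Set
    ⟦ [] ⟧C d = ⊥
    ⟦ l ∷ c ⟧C d = ⟦ l ⟧L d ⊎ ⟦ c ⟧C d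

    ⟦_⟧S : ClauseSet → Δ → Set
    ⟦ [] ⟧S d = ⊤
    ⟦ c ∷ F ⟧S d = ⟦ c ⟧C d × ⟦ F ⟧S d

Satisfiable : ClauseSet → Set₁
Satisfiable F = Σ Interpretation λ I → Σ (Interpretation.Δ I) λ d → ⟦_⟧S I F d

mutual
  LitEq : Lit → Lit → Set
  LitEq (pos A) (pos B) = A ≡ B
  LitEq (neg A) (neg B) = A ≡ B
  LitEq (exs R F) (exs S G) = R ≡ S × (SubCS F G × SubCS G F)
  LitEq (all R F) (all S G) = R ≡ S × (SubCS F G × SubCS G F)
  LitEq _ _ = ⊥

  MemL : Lit → Clause → Set
  MemL l [] = ⊥
  MemL l (m ∷ c) = LitEq l m ⊎ MemL l c

  SubCl : Clause → Clause → Set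
  SubCl [] d = ⊤
  SubCl (l ∷ c) d = MemL l d × SubCl c d

  ClEq : Clause → Clause → Set
  ClEq c d = SubCl c d × SubCl d c

  MemC : Clause → ClauseSet → Set
  MemC c [] = ⊥
  MemC c (d ∷ G) = ClEq c d ⊎ MemC c G

  SubCS : ClauseSet → ClauseSet → Set
  SubCS [] G = ⊤
  SubCS (c ∷ F) G = MemC c G × SubCS F G

CSEq : ClauseSet → ClauseSet → Set
CSEq F G = SubCS F G × SubCS G F

-- Complementary literal.  negCNF F is CNF(¬F): pushing the negation
-- inwards turns  ⋀ᵢ ⋁ⱼ Lᵢⱼ  into  ⋁ᵢ ⋀ⱼ ¬Lᵢⱼ, and distributing ⊔ over ⊓
-- yields one clause per choice of one literal from each clause of F.

cross : List Lit → ClauseSet → ClauseSet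
cross [] ds = []
cross (l ∷ ls) ds = map (l ∷_) ds ++ cross ls ds

mutual
  comp : Lit → Lit
  comp (pos A) = neg A
  comp (neg A) = pos A
  comp (exs R F) = all R (negCNF F)
  comp (all R F) = exs R (negCNF F)

  compCl : Clause → Clause
  compCl [] = []
  compCl (l ∷ c) = comp l ∷ compCl c

  negCNF : ClauseSet → ClauseSet
  negCNF [] = [] ∷ []
  negCNF (c ∷ F) = cross (compCl c) (negCNF F)

data Remove {A : Set} (P : A → Set) : List A → List A → Set where
  []   : Remove P [] []
  drop : ∀ {x xs ys} → P x → Remove P xs ys → Remove P (x ∷ xs) ys
  keep : ∀ {x xs ys} → ¬ P x → Remove P xs ys → Remove P (x ∷ xs) (x ∷ ys)

IsUnit : Clause → Set
IsUnit c = Σ Lit λ L → ClEq c (L ∷ [])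

AllUnit : ClauseSet → Set
AllUnit F = All IsUnit F

data A3Form : Lit → Set where
  pos : ∀ {A} → A3Form (pos A)
  neg : ∀ {A} → A3Form (neg A)
  exs : ∀ {R F} → A3Form (exs R F)

AllUnitA3 : ClauseSet → Set
AllUnitA3 F = All (λ c → Σ Lit λ L → A3Form L × ClEq c (L ∷ [])) F

A1Clause : Lit → Clause → Clause → Set
A1Clause L c c' =
  (MemL L c × c' ≡ L ∷ [])
  ⊎ (¬ MemL L c × Remove (λ x → LitEq x (comp L)) c c')

-- A1⁺ applied to F with chosen literal L (L ∈ CL ∈ F), giving F'.
-- The rule counts as applicable only if it actually changes F.
data A1 (F F' : ClauseSet) : Set where
  a1 : (L : Lit) (CL : Clause) → CL ∈ F → L ∈ CL →
       Pointwise (A1Clause L) F F' → ¬ CSEq F F' → A1 F F'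

addEx : RoleName → ClauseSet → Lit → Lit
addEx R F₁ (exs S F₂) with R ≟ S
... | yes _ = exs S (F₁ ++ F₂)
... | no _  = exs S F₂
addEx R F₁ l = l

data A2 (F F' : ClauseSet) : Set where
  a2 : (R : RoleName) (F₁ : ClauseSet) (CL : Clause) →
       AllUnit F → CL ∈ F → all R F₁ ∈ CL →
       (G : ClauseSet) → Remove (MemL (all R F₁)) F G →
       F' ≡ map (map (addEx R F₁)) G → A2 F F'

data A3 (F F' F₁ : ClauseSet) : Set where
  a3 : (R : RoleName) (CL : Clause) →
       AllUnitA3 F → CL ∈ F → exs R F₁ ∈ CL →
       Remove (λ c → ClEq c (exs R F₁ ∷ [])) F F' → A3 F F' F₁

Family : Set
Family = List ClauseSet

data Step : Family → Family → Set where
  stepA1 : ∀ xs ys {F F'} → A1 F F' → Step (xs ++ F ∷ ys) (xs ++ F' ∷ ys)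
  stepA2 : ∀ xs ys {F F'} → A2 F F' → Step (xs ++ F ∷ ys) (xs ++ F' ∷ ys)
  stepA3 : ∀ xs ys {F F' F₁} → A3 F F' F₁ →
           Step (xs ++ F ∷ ys) (xs ++ F' ∷ ys ++ F₁ ∷ [])

Derivation : Family → Family → Set
Derivation = Star Step

Complete : Family → Set
Complete S = (S' : Family) → ¬ Step S S'

ClashFreeCS : ClauseSet → Set
ClashFreeCS F = ¬ ([] ∈ F) × ((L : Lit) → ¬ (MemC (L ∷ []) F × MemC (comp L ∷ []) F))

ClashFree : Family → Set
ClashFree S = All ClashFreeCS S

{-# OPTIONS --safe #-}
-- Fix a model I and an element d with d ∈ F^I, and let d steer the rule
-- applications so that every clause set stays true at its own element:
-- A1⁺ chooses a true literal (clauses containing it become true units, the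
-- other clauses only lose the false complement), A2⁺ uses a true ∀R.F₁, whose
-- body then also holds at every R-successor demanded by the ∃R-literals, and
-- A3 splits off a true ∃R.F₁, whose body is true at a witnessing R-successor.
-- When none of these moves is possible, the clause set consists of unit
-- clauses of true atoms: no rule applies to it, and it is clash-free because
-- all its literals hold at one element.
-- The process terminates since no rule increases the modal depth of a clause
-- set, A3 spawns sets of strictly smaller depth, and each rule (A1⁺ only
-- counts when it changes F) decreases the number of clauses plus literals of
-- the set it acts on.
module Submission where

open import Defs
open import Data.Nat using (ℕ; suc; _<_; _≤_; _+_; _⊔_; z≤n; s≤s; _≟_)
open import Data.Nat.Properties
open import Data.Nat.Induction using (<-wellFounded)
open import Data.List using (List; []; _∷_; _++_; map; length)
open import Data.List.Properties using (++-assoc; ++-identityʳ; length-map)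
open import Data.List.Membership.Propositional using (_∈_; find)
open import Data.List.Relation.Unary.Any using (Any; here; there)
open import Data.List.Relation.Unary.All as All using (All; []; _∷_)
open import Data.List.Relation.Unary.All.Properties using (++⁺; ++⁻ʳ)
open import Data.List.Relation.Binary.Pointwise as Pointwise using (Pointwise; []; _∷_; Pointwise-length)
open import Data.Product using (Σ; ∃; ∃₂; _×_; _,_; proj₁; proj₂; swap)
open import Data.Sum using (_⊎_; inj₁; inj₂)
open import Data.Empty using (⊥-elim)
open import Data.Unit using (⊤; tt)
open import Relation.Nullary using (¬_; Dec; yes; no)
open import Relation.Nullary.Decidable using (_×-dec_; _⊎-dec_)
open import Relation.Binary.PropositionalEquality using (_≡_; refl; sym; cong; cong₂; subst; subst₂)
open import Relation.Binary.Construct.Closure.ReflexiveTransitive using (ε; _◅_; _◅◅_)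
open import Induction.WellFounded using (Acc; acc)

mutual
  LitEq? : (l m : Lit) → Dec (LitEq l m)
  LitEq? (pos A) (pos B) = A ≟ B
  LitEq? (pos A) (neg B) = no λ ()
  LitEq? (pos A) (exs S G) = no λ ()
  LitEq? (pos A) (all S G) = no λ ()
  LitEq? (neg A) (pos B) = no λ ()
  LitEq? (neg A) (neg B) = A ≟ B
  LitEq? (neg A) (exs S G) = no λ ()
  LitEq? (neg A) (all S G) = no λ ()
  LitEq? (exs R F) (pos B) = no λ ()
  LitEq? (exs R F) (neg B) = no λ ()
  LitEq? (exs R F) (exs S G) = R ≟ S ×-dec (SubCS? F G ×-dec SubCS? G F)
  LitEq? (exs R F) (all S G) = no λ ()
  LitEq? (all R F) (pos B) = no λ ()
  LitEq? (all R F) (neg B) = no λ ()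
  LitEq? (all R F) (exs S G) = no λ ()
  LitEq? (all R F) (all S G) = R ≟ S ×-dec (SubCS? F G ×-dec SubCS? G F)

  MemL? : (l : Lit) (c : Clause) → Dec (MemL l c)
  MemL? l [] = no λ ()
  MemL? l (m ∷ c) = LitEq? l m ⊎-dec MemL? l c

  SubCl? : (c d : Clause) → Dec (SubCl c d)
  SubCl? [] d = yes tt
  SubCl? (l ∷ c) d = MemL? l d ×-dec SubCl? c d

  ClEq? : (c d : Clause) → Dec (ClEq c d)
  ClEq? c d = SubCl? c d ×-dec SubCl? d c

  MemC? : (c : Clause) (G : ClauseSet) → Dec (MemC c G)
  MemC? c [] = no λ ()
  MemC? c (d ∷ G) = ClEq? c d ⊎-dec MemC? c G

  SubCS? : (F G : ClauseSet) → Dec (SubCS F G)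
  SubCS? [] G = yes tt
  SubCS? (c ∷ F) G = MemC? c G ×-dec SubCS? F G

SubCl-there : ∀ {c d} x → SubCl c d → SubCl c (x ∷ d)
SubCl-there {[]} x s = tt
SubCl-there {l ∷ c} x (m , s) = inj₂ m , SubCl-there x s

SubCS-there : ∀ {F G} x → SubCS F G → SubCS F (x ∷ G)
SubCS-there {[]} x s = tt
SubCS-there {c ∷ F} x (m , s) = inj₂ m , SubCS-there x s

mutual
  LitEq-refl : ∀ l → LitEq l l
  LitEq-refl (pos A) = refl
  LitEq-refl (neg A) = refl
  LitEq-refl (exs R F) = refl , SubCS-refl F , SubCS-refl F
  LitEq-refl (all R F) = refl , SubCS-refl F , SubCS-refl F

  SubCl-refl : ∀ c → SubCl c c
  SubCl-refl [] = tt
  SubCl-refl (l ∷ c) = inj₁ (LitEq-refl l) , SubCl-there l (SubCl-refl c)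

  SubCS-refl : ∀ F → SubCS F F
  SubCS-refl [] = tt
  SubCS-refl (c ∷ F) = inj₁ (ClEq-refl c) , SubCS-there c (SubCS-refl F)

  ClEq-refl : ∀ c → ClEq c c
  ClEq-refl c = SubCl-refl c , SubCl-refl c

∈⇒MemL : ∀ {l c} → l ∈ c → MemL l c
∈⇒MemL {l} (here refl) = inj₁ (LitEq-refl l)
∈⇒MemL (there p) = inj₂ (∈⇒MemL p)

SubCl-lookup : ∀ {c d l} → SubCl c d → l ∈ c → MemL l d
SubCl-lookup (m , s) (here refl) = m
SubCl-lookup (m , s) (there p) = SubCl-lookup s p

SubCS-lookup : ∀ {F G c} → SubCS F G → c ∈ F → MemC c G
SubCS-lookup (m , s) (here refl) = m
SubCS-lookup (m , s) (there p) = SubCS-lookup s p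

MemC-lookup : ∀ {c G} {Q : Clause → Set} → MemC c G → All Q G → ∃ λ d → ClEq c d × Q d
MemC-lookup {G = d ∷ G} (inj₁ e) (q ∷ qs) = d , e , q
MemC-lookup {G = d ∷ G} (inj₂ m) (q ∷ qs) = MemC-lookup m qs

Pointwise-ClEq⇒SubCS : ∀ {F G} → Pointwise ClEq F G → SubCS F G
Pointwise-ClEq⇒SubCS [] = tt
Pointwise-ClEq⇒SubCS {G = d ∷ G} (e ∷ es) = inj₁ e , SubCS-there d (Pointwise-ClEq⇒SubCS es)

Pointwise-ClEq⇒CSEq : ∀ {F G} → Pointwise ClEq F G → CSEq F G
Pointwise-ClEq⇒CSEq es = Pointwise-ClEq⇒SubCS es , Pointwise-ClEq⇒SubCS (Pointwise.symmetric swap es)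

module _ {A : Set} {P : A → Set} where

  remove : ((x : A) → Dec (P x)) → (xs : List A) → ∃ (Remove P xs)
  remove P? [] = [] , []
  remove P? (x ∷ xs) with P? x | remove P? xs
  ... | yes px | ys , r = ys , drop px r
  ... | no ¬px | ys , r = x ∷ ys , keep ¬px r

  Remove-length-≤ : ∀ {xs ys} → Remove P xs ys → length ys ≤ length xs
  Remove-length-≤ [] = z≤n
  Remove-length-≤ (drop p r) = m≤n⇒m≤1+n (Remove-length-≤ r)
  Remove-length-≤ (keep p r) = s≤s (Remove-length-≤ r)

  Remove-length-< : ∀ {xs ys x} → Remove P xs ys → x ∈ xs → P x → length ys < length xs
  Remove-length-< (drop p r) (here refl) px = s≤s (Remove-length-≤ r)
  Remove-length-< (keep p r) (here refl) px = ⊥-elim (p px)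
  Remove-length-< (drop p r) (there q) px = m≤n⇒m≤1+n (Remove-length-< r q px)
  Remove-length-< (keep p r) (there q) px = s≤s (Remove-length-< r q px)

  Remove-All : ∀ {Q : A → Set} {xs ys} → Remove P xs ys → All Q xs → All Q ys
  Remove-All [] [] = []
  Remove-All (drop p r) (q ∷ qs) = Remove-All r qs
  Remove-All (keep p r) (q ∷ qs) = q ∷ Remove-All r qs

  Remove-Any : ∀ {Q : A → Set} {xs ys} → Remove P xs ys → (∀ {x} → P x → ¬ Q x) → Any Q xs → Any Q ys
  Remove-Any (drop p r) P⇒¬Q (here q) = ⊥-elim (P⇒¬Q p q)
  Remove-Any (keep p r) P⇒¬Q (here q) = here q
  Remove-Any (drop p r) P⇒¬Q (there a) = Remove-Any r P⇒¬Q a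
  Remove-Any (keep p r) P⇒¬Q (there a) = there (Remove-Any r P⇒¬Q a)

  Remove-none : ∀ {xs ys} → Remove P xs ys → All (λ x → ¬ P x) xs → ys ≡ xs
  Remove-none [] [] = refl
  Remove-none (drop p r) (¬p ∷ _) = ⊥-elim (¬p p)
  Remove-none (keep p r) (_ ∷ ¬ps) = cong (_ ∷_) (Remove-none r ¬ps)

Remove-MemL : ∀ {P l c c'} → Remove P c c' → MemL l c' → MemL l c
Remove-MemL (drop p r) m = inj₂ (Remove-MemL r m)
Remove-MemL (keep p r) (inj₁ e) = inj₁ e
Remove-MemL (keep p r) (inj₂ m) = inj₂ (Remove-MemL r m)

any-or-all : {A : Set} {P Q R : A → Set} → (∀ {x} → P x → Q x ⊎ R x) →
             ∀ {xs} → All P xs → Any Q xs ⊎ All R xs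
any-or-all split [] = inj₂ []
any-or-all split (p ∷ ps) with split p | any-or-all split ps
... | inj₁ q | _ = inj₁ (here q)
... | inj₂ r | inj₁ qs = inj₁ (there qs)
... | inj₂ r | inj₂ rs = inj₂ (r ∷ rs)

data Atom : Lit → Set where
  pos : ∀ {A} → Atom (pos A)
  neg : ∀ {A} → Atom (neg A)

all-or-A3Form : ∀ L → (∃₂ λ R F₁ → L ≡ all R F₁) ⊎ A3Form L
all-or-A3Form (pos A) = inj₂ pos
all-or-A3Form (neg A) = inj₂ neg
all-or-A3Form (exs R F) = inj₂ exs
all-or-A3Form (all R F) = inj₁ (R , F , refl)

exs-or-Atom : ∀ {L} → A3Form L → (∃₂ λ R F₁ → L ≡ exs R F₁) ⊎ Atom L
exs-or-Atom pos = inj₂ pos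
exs-or-Atom neg = inj₂ neg
exs-or-Atom (exs {R} {F}) = inj₁ (R , F , refl)

LitEq-Atom : ∀ {a x} → Atom a → LitEq x a → x ≡ a
LitEq-Atom {pos A} {pos B} pos e = cong pos e
LitEq-Atom {neg A} {neg B} neg e = cong neg e

SubCl-Atom : ∀ {a c} → Atom a → SubCl c (a ∷ []) → All (_≡ a) c
SubCl-Atom {c = []} atom s = []
SubCl-Atom {c = x ∷ c} atom (inj₁ e , s) = LitEq-Atom atom e ∷ SubCl-Atom atom s

MemL-All≡ : ∀ {l a c} → MemL l c → All (_≡ a) c → LitEq l a
MemL-All≡ (inj₁ e) (refl ∷ _) = e
MemL-All≡ (inj₂ m) (_ ∷ r) = MemL-All≡ m r

data LitDepth≤ : ℕ → Lit → Set where
  pos : ∀ {k A} → LitDepth≤ k (pos A)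
  neg : ∀ {k A} → LitDepth≤ k (neg A)
  exs : ∀ {k j R F} → j < k → All (All (LitDepth≤ j)) F → LitDepth≤ k (exs R F)
  all : ∀ {k j R F} → j < k → All (All (LitDepth≤ j)) F → LitDepth≤ k (all R F)

Depth≤ : ℕ → ClauseSet → Set
Depth≤ k F = All (All (LitDepth≤ k)) F

LitDepth≤-mono : ∀ {j k l} → j ≤ k → LitDepth≤ j l → LitDepth≤ k l
LitDepth≤-mono j≤k pos = pos
LitDepth≤-mono j≤k neg = neg
LitDepth≤-mono j≤k (exs i<j b) = exs (<-≤-trans i<j j≤k) b
LitDepth≤-mono j≤k (all i<j b) = all (<-≤-trans i<j j≤k) b

Depth≤-mono : ∀ {j k F} → j ≤ k → Depth≤ j F → Depth≤ k F
Depth≤-mono j≤k = All.map (All.map (LitDepth≤-mono j≤k))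

exs-depth : ∀ {k R F} → LitDepth≤ k (exs R F) → ∃ λ j → j < k × Depth≤ j F
exs-depth (exs j<k b) = _ , j<k , b

Depth≤-lookup : ∀ {k F CL l} → Depth≤ k F → CL ∈ F → l ∈ CL → LitDepth≤ k l
Depth≤-lookup b CL∈F l∈CL = All.lookup (All.lookup b CL∈F) l∈CL

mutual
  litDepth : ∀ l → ∃ λ k → LitDepth≤ k l
  litDepth (pos A) = 0 , pos
  litDepth (neg A) = 0 , neg
  litDepth (exs R F) = let k , b = depth F in suc k , exs ≤-refl b
  litDepth (all R F) = let k , b = depth F in suc k , all ≤-refl b

  clauseDepth : ∀ c → ∃ λ k → All (LitDepth≤ k) c
  clauseDepth [] = 0 , []
  clauseDepth (l ∷ c) with litDepth l | clauseDepth c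
  ... | k₁ , b₁ | k₂ , b₂ =
    k₁ ⊔ k₂ , LitDepth≤-mono (m≤m⊔n k₁ k₂) b₁ ∷ All.map (LitDepth≤-mono (m≤n⊔m k₁ k₂)) b₂

  depth : ∀ F → ∃ λ k → Depth≤ k F
  depth [] = 0 , []
  depth (c ∷ F) with clauseDepth c | depth F
  ... | k₁ , b₁ | k₂ , b₂ =
    k₁ ⊔ k₂ , All.map (LitDepth≤-mono (m≤m⊔n k₁ k₂)) b₁ ∷ Depth≤-mono (m≤n⊔m k₁ k₂) b₂

literals : ClauseSet → ℕ
literals [] = 0
literals (c ∷ F) = length c + literals F

size : ClauseSet → ℕ
size F = length F + literals F

Remove-literals-≤ : ∀ {P F G} → Remove P F G → literals G ≤ literals F
Remove-literals-≤ [] = z≤n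
Remove-literals-≤ (drop {x = c} p r) = ≤-trans (Remove-literals-≤ r) (m≤n+m _ (length c))
Remove-literals-≤ (keep {x = c} p r) = +-monoʳ-≤ (length c) (Remove-literals-≤ r)

Remove-size-< : ∀ {P F G CL} → Remove P F G → CL ∈ F → P CL → size G < size F
Remove-size-< r CL∈F p = +-mono-<-≤ (Remove-length-< r CL∈F p) (Remove-literals-≤ r)

literals-map : ∀ f G → literals (map (map f) G) ≡ literals G
literals-map f [] = refl
literals-map f (c ∷ G) = cong₂ _+_ (length-map f c) (literals-map f G)

size-map : ∀ f G → size (map (map f) G) ≡ size G
size-map f G = cong₂ _+_ (length-map (map f) G) (literals-map f G)

a1-clause : ∀ L c → ∃ (A1Clause L c)
a1-clause L c with MemL? L c
... | yes m = L ∷ [] , inj₁ (m , refl)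
... | no ¬m = let c' , r = remove (λ x → LitEq? x (comp L)) c in c' , inj₂ (¬m , r)

a1-clauses : ∀ L F → ∃ (Pointwise (A1Clause L) F)
a1-clauses L [] = [] , []
a1-clauses L (c ∷ F) =
  let c' , p = a1-clause L c ; F' , ps = a1-clauses L F in c' ∷ F' , p ∷ ps

A1Clause-length-≤ : ∀ {L c c'} → A1Clause L c c' → length c' ≤ length c
A1Clause-length-≤ {c = _ ∷ _} (inj₁ (_ , refl)) = s≤s z≤n
A1Clause-length-≤ (inj₂ (_ , r)) = Remove-length-≤ r

non-unit-length : ∀ {L CL} → L ∈ CL → ¬ ClEq CL (L ∷ []) → 1 < length CL
non-unit-length {CL = _ ∷ []} (here refl) non-unit = ⊥-elim (non-unit (ClEq-refl _))
non-unit-length {CL = _ ∷ _ ∷ _} _ _ = s≤s (s≤s z≤n)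

a1-literals-≤ : ∀ {L F F'} → Pointwise (A1Clause L) F F' → literals F' ≤ literals F
a1-literals-≤ [] = z≤n
a1-literals-≤ (p ∷ ps) = +-mono-≤ (A1Clause-length-≤ p) (a1-literals-≤ ps)

a1-literals-< : ∀ {L F F' CL} → Pointwise (A1Clause L) F F' → CL ∈ F → L ∈ CL →
                ¬ ClEq CL (L ∷ []) → literals F' < literals F
a1-literals-< (inj₁ (_ , refl) ∷ ps) (here refl) L∈CL non-unit =
  +-mono-<-≤ (non-unit-length L∈CL non-unit) (a1-literals-≤ ps)
a1-literals-< (inj₂ (¬m , _) ∷ ps) (here refl) L∈CL non-unit = ⊥-elim (¬m (∈⇒MemL L∈CL))
a1-literals-< (p ∷ ps) (there CL∈F) L∈CL non-unit =
  +-mono-≤-< (A1Clause-length-≤ p) (a1-literals-< ps CL∈F L∈CL non-unit)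

a1-size-< : ∀ {L F F' CL} → Pointwise (A1Clause L) F F' → CL ∈ F → L ∈ CL →
            ¬ ClEq CL (L ∷ []) → size F' < size F
a1-size-< pw CL∈F L∈CL non-unit =
  +-mono-≤-< (≤-reflexive (sym (Pointwise-length pw))) (a1-literals-< pw CL∈F L∈CL non-unit)

a1-shape : ∀ {L F F'} → Pointwise (A1Clause L) F F' → All (λ c → c ≡ L ∷ [] ⊎ ¬ MemL L c) F'
a1-shape [] = []
a1-shape (inj₁ (_ , refl) ∷ ps) = inj₁ refl ∷ a1-shape ps
a1-shape (inj₂ (¬m , r) ∷ ps) = inj₂ (λ m → ¬m (Remove-MemL r m)) ∷ a1-shape ps

a1-changes : ∀ {L F F' CL} → Pointwise (A1Clause L) F F' → CL ∈ F → L ∈ CL →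
             ¬ ClEq CL (L ∷ []) → ¬ CSEq F F'
a1-changes pw CL∈F L∈CL non-unit (F⊆F' , _) with MemC-lookup (SubCS-lookup F⊆F' CL∈F) (a1-shape pw)
... | _ , CL≈c , inj₁ refl = non-unit CL≈c
... | _ , CL≈c , inj₂ ¬m = ¬m (SubCl-lookup (proj₁ CL≈c) L∈CL)

a1-depth : ∀ {k L F F'} → Pointwise (A1Clause L) F F' → LitDepth≤ k L → Depth≤ k F → Depth≤ k F'
a1-depth [] bL [] = []
a1-depth (inj₁ (_ , refl) ∷ ps) bL (b ∷ bs) = (bL ∷ []) ∷ a1-depth ps bL bs
a1-depth (inj₂ (_ , r) ∷ ps) bL (b ∷ bs) = Remove-All r b ∷ a1-depth ps bL bs

addEx-depth : ∀ {k R F₁ l} → LitDepth≤ k (all R F₁) → LitDepth≤ k l → LitDepth≤ k (addEx R F₁ l)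
addEx-depth {l = pos A} _ b = b
addEx-depth {l = neg A} _ b = b
addEx-depth {l = all S F₂} _ b = b
addEx-depth {R = R} {l = exs S F₂} (all {j = j₁} j₁<k b₁) (exs {j = j₂} j₂<k b₂) with R ≟ S
... | yes _ =
  exs (⊔-lub j₁<k j₂<k) (++⁺ (Depth≤-mono (m≤m⊔n j₁ j₂) b₁) (Depth≤-mono (m≤n⊔m j₁ j₂) b₂))
... | no _ = exs j₂<k b₂

a2-depth : ∀ {k R F₁ G} → LitDepth≤ k (all R F₁) → Depth≤ k G → Depth≤ k (map (map (addEx R F₁)) G)
a2-depth b∀ [] = []
a2-depth b∀ (b ∷ bs) = clause b ∷ a2-depth b∀ bs
  where
  clause : ∀ {c} → All (LitDepth≤ _) c → All (LitDepth≤ _) (map (addEx _ _) c)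
  clause [] = []
  clause (x ∷ xs) = addEx-depth b∀ x ∷ clause xs

Irreducible : ClauseSet → Set
Irreducible F = (∀ F' → ¬ A1 F F') × (∀ F' → ¬ A2 F F') × (∀ F' F₁ → ¬ A3 F F' F₁)

Settled : ClauseSet → Set
Settled F = Irreducible F × ClashFreeCS F

All-Settled⇒Complete : ∀ {S} → All Settled S → Complete S
All-Settled⇒Complete ss _ (stepA1 xs ys r) = proj₁ (proj₁ (All.head (++⁻ʳ xs ss))) _ r
All-Settled⇒Complete ss _ (stepA2 xs ys r) = proj₁ (proj₂ (proj₁ (All.head (++⁻ʳ xs ss)))) _ r
All-Settled⇒Complete ss _ (stepA3 xs ys r) = proj₂ (proj₂ (proj₁ (All.head (++⁻ʳ xs ss)))) _ _ r

-- F, sitting between the family parts xs and ys, has been worked off into the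
-- settled set result, while the sets spawned by A3 were appended at the end.
record Saturation (xs : Family) (F : ClauseSet) (ys : Family) : Set where
  constructor saturation
  field
    {result}        : ClauseSet
    {spawned}       : Family
    derivation      : Derivation (xs ++ F ∷ ys) (xs ++ result ∷ ys ++ spawned)
    result-settled  : Settled result
    spawned-settled : All Settled spawned

settled-saturation : ∀ {xs F ys} → Settled F → Saturation xs F ys
settled-saturation {xs} {F} {ys} s =
  saturation (subst (λ zs → Derivation (xs ++ F ∷ ys) (xs ++ F ∷ zs)) (sym (++-identityʳ ys)) ε) s []

infixr 5 _◅ˢ_
_◅ˢ_ : ∀ {xs F F' ys} → Step (xs ++ F ∷ ys) (xs ++ F' ∷ ys) → Saturation xs F' ys → Saturation xs F ys
step ◅ˢ saturation der s ss = saturation (step ◅ der) s ss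

spawn-saturation : ∀ {xs F F' F₁ ys} → Step (xs ++ F ∷ ys) (xs ++ F' ∷ ys ++ F₁ ∷ []) →
                   (s₁ : Saturation (xs ++ F' ∷ ys) F₁ []) →
                   Saturation xs F' (ys ++ Saturation.result s₁ ∷ Saturation.spawned s₁) →
                   Saturation xs F ys
spawn-saturation {xs} {F' = F'} {F₁} {ys} step
                 (saturation {G₁} {K₁} der₁ s₁ ss₁) (saturation {G} {K₂} der₂ s ss₂) =
  saturation (step ◅ (der₁′ ◅◅ der₂′)) s (s₁ ∷ ++⁺ ss₁ ss₂)
  where
  der₁′ : Derivation (xs ++ F' ∷ ys ++ F₁ ∷ []) (xs ++ F' ∷ ys ++ G₁ ∷ K₁)
  der₁′ = subst₂ Derivation (++-assoc xs (F' ∷ ys) (F₁ ∷ [])) (++-assoc xs (F' ∷ ys) (G₁ ∷ K₁)) der₁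
  der₂′ : Derivation (xs ++ F' ∷ ys ++ G₁ ∷ K₁) (xs ++ G ∷ ys ++ G₁ ∷ K₁ ++ K₂)
  der₂′ = subst (Derivation _) (cong (λ zs → xs ++ G ∷ zs) (++-assoc ys (G₁ ∷ K₁) K₂)) der₂

module Semantics (I : Interpretation) where
  open Interpretation I

  ⟦_⟧ˡ : Lit → Δ → Set
  ⟦_⟧ˡ = ⟦_⟧L I

  ⟦_⟧ᶜ : Clause → Δ → Set
  ⟦_⟧ᶜ = ⟦_⟧C I

  ⟦_⟧ˢ : ClauseSet → Δ → Set
  ⟦_⟧ˢ = ⟦_⟧S I

  _⊨_ : Δ → ClauseSet → Set
  d ⊨ F = All (λ c → ⟦ c ⟧ᶜ d) F

  mutual
    ⟦⟧-LitEq : ∀ {l m d} → LitEq l m → ⟦ l ⟧ˡ d → ⟦ m ⟧ˡ d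
    ⟦⟧-LitEq {pos A} {pos B} refl t = t
    ⟦⟧-LitEq {neg A} {neg B} refl t = t
    ⟦⟧-LitEq {exs R F} {exs S G} (refl , _ , G⊆F) (e , r , t) = e , r , ⟦⟧-SubCS G⊆F t
    ⟦⟧-LitEq {all R F} {all S G} (refl , _ , G⊆F) t = λ e r → ⟦⟧-SubCS G⊆F (t e r)

    ⟦⟧-MemL : ∀ {l c d} → MemL l c → ⟦ l ⟧ˡ d → ⟦ c ⟧ᶜ d
    ⟦⟧-MemL {c = m ∷ c} (inj₁ e) t = inj₁ (⟦⟧-LitEq e t)
    ⟦⟧-MemL {c = m ∷ c} (inj₂ e) t = inj₂ (⟦⟧-MemL e t)

    ⟦⟧-SubCl : ∀ {c c' d} → SubCl c c' → ⟦ c ⟧ᶜ d → ⟦ c' ⟧ᶜ d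
    ⟦⟧-SubCl {l ∷ c} (m , s) (inj₁ t) = ⟦⟧-MemL m t
    ⟦⟧-SubCl {l ∷ c} (m , s) (inj₂ t) = ⟦⟧-SubCl s t

    ⟦⟧-MemC : ∀ {c G d} → MemC c G → ⟦ G ⟧ˢ d → ⟦ c ⟧ᶜ d
    ⟦⟧-MemC {G = _ ∷ G} (inj₁ (_ , d⊆c)) (t , _) = ⟦⟧-SubCl d⊆c t
    ⟦⟧-MemC {G = _ ∷ G} (inj₂ m) (_ , t) = ⟦⟧-MemC m t

    ⟦⟧-SubCS : ∀ {F G d} → SubCS F G → ⟦ G ⟧ˢ d → ⟦ F ⟧ˢ d
    ⟦⟧-SubCS {[]} _ _ = tt
    ⟦⟧-SubCS {c ∷ F} (m , s) t = ⟦⟧-MemC m t , ⟦⟧-SubCS s t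

  ⟦⟧-++⁻ : ∀ F {G d} → ⟦ F ++ G ⟧ˢ d → ⟦ F ⟧ˢ d × ⟦ G ⟧ˢ d
  ⟦⟧-++⁻ [] t = tt , t
  ⟦⟧-++⁻ (c ∷ F) (tc , t) = let tF , tG = ⟦⟧-++⁻ F t in (tc , tF) , tG

  ⟦⟧-++⁺ : ∀ F {G d} → ⟦ F ⟧ˢ d → ⟦ G ⟧ˢ d → ⟦ F ++ G ⟧ˢ d
  ⟦⟧-++⁺ [] _ t = t
  ⟦⟧-++⁺ (c ∷ F) (tc , tF) tG = tc , ⟦⟧-++⁺ F tF tG

  ⟦⟧-map-∷ : ∀ {l d} ds → ¬ ⟦ l ⟧ˡ d → ⟦ map (l ∷_) ds ⟧ˢ d → ⟦ ds ⟧ˢ d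
  ⟦⟧-map-∷ [] ¬t _ = tt
  ⟦⟧-map-∷ (c ∷ ds) ¬t (inj₁ t , _) = ⊥-elim (¬t t)
  ⟦⟧-map-∷ (c ∷ ds) ¬t (inj₂ tc , t) = tc , ⟦⟧-map-∷ ds ¬t t

  mutual
    comp-disjoint : ∀ l {d} → ⟦ comp l ⟧ˡ d → ¬ ⟦ l ⟧ˡ d
    comp-disjoint (pos A) ¬t t = ¬t t
    comp-disjoint (neg A) t ¬t = ¬t t
    comp-disjoint (exs R F) t (e , r , tF) = negCNF-disjoint F (t e r) tF
    comp-disjoint (all R F) (e , r , t) tF = negCNF-disjoint F t (tF e r)

    negCNF-disjoint : ∀ F {d} → ⟦ negCNF F ⟧ˢ d → ¬ ⟦ F ⟧ˢ d
    negCNF-disjoint [] (() , _) _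
    negCNF-disjoint (c ∷ F) t (tc , tF) = negCNF-disjoint F (cross-compCl c t tc) tF

    -- a true literal l of c falsifies comp l, so the clauses comp l ∷ d of the
    -- product reduce to the clauses d of ds
    cross-compCl : ∀ c {ds d} → ⟦ cross (compCl c) ds ⟧ˢ d → ⟦ c ⟧ᶜ d → ⟦ ds ⟧ˢ d
    cross-compCl (l ∷ c) {ds} t (inj₁ tl) =
      ⟦⟧-map-∷ ds (λ t' → comp-disjoint l t' tl) (proj₁ (⟦⟧-++⁻ (map (comp l ∷_) ds) t))
    cross-compCl (l ∷ c) {ds} t (inj₂ tc) =
      cross-compCl c (proj₂ (⟦⟧-++⁻ (map (comp l ∷_) ds) t)) tc

  ⟦⟧ᶜ⇒Any : ∀ {c d} → ⟦ c ⟧ᶜ d → Any (λ l → ⟦ l ⟧ˡ d) c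
  ⟦⟧ᶜ⇒Any {_ ∷ _} (inj₁ t) = here t
  ⟦⟧ᶜ⇒Any {_ ∷ _} (inj₂ t) = there (⟦⟧ᶜ⇒Any t)

  Any⇒⟦⟧ᶜ : ∀ {c d} → Any (λ l → ⟦ l ⟧ˡ d) c → ⟦ c ⟧ᶜ d
  Any⇒⟦⟧ᶜ (here t) = inj₁ t
  Any⇒⟦⟧ᶜ (there a) = inj₂ (Any⇒⟦⟧ᶜ a)

  ⟦⟧ˢ⇒⊨ : ∀ {F d} → ⟦ F ⟧ˢ d → d ⊨ F
  ⟦⟧ˢ⇒⊨ {[]} _ = []
  ⟦⟧ˢ⇒⊨ {_ ∷ _} (tc , tF) = tc ∷ ⟦⟧ˢ⇒⊨ tF

  ⊨⇒⟦⟧ˢ : ∀ {F d} → d ⊨ F → ⟦ F ⟧ˢ d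
  ⊨⇒⟦⟧ˢ [] = tt
  ⊨⇒⟦⟧ˢ (tc ∷ tF) = tc , ⊨⇒⟦⟧ˢ tF

  ⊨⇒ClashFreeCS : ∀ {d F} → d ⊨ F → ClashFreeCS F
  ⊨⇒ClashFreeCS {d} {F} tF = All.lookup tF , λ L (L∈F , L̅∈F) →
    comp-disjoint L (unit-true (comp L) L̅∈F) (unit-true L L∈F)
    where
    unit-true : ∀ L → MemC (L ∷ []) F → ⟦ L ⟧ˡ d
    unit-true L m with ⟦⟧-MemC {G = F} m (⊨⇒⟦⟧ˢ tF)
    ... | inj₁ t = t

  a1-⊨ : ∀ {L F F' d} → ⟦ L ⟧ˡ d → Pointwise (A1Clause L) F F' → d ⊨ F → d ⊨ F'
  a1-⊨ tL [] [] = []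
  a1-⊨ tL (inj₁ (_ , refl) ∷ ps) (_ ∷ ts) = inj₁ tL ∷ a1-⊨ tL ps ts
  a1-⊨ {L} tL (inj₂ (_ , r) ∷ ps) (t ∷ ts) =
    Any⇒⟦⟧ᶜ (Remove-Any r (λ e t' → comp-disjoint L (⟦⟧-LitEq e t') tL) (⟦⟧ᶜ⇒Any t)) ∷ a1-⊨ tL ps ts

  addEx-⟦⟧ : ∀ {R F₁ l d} → ⟦ all R F₁ ⟧ˡ d → ⟦ l ⟧ˡ d → ⟦ addEx R F₁ l ⟧ˡ d
  addEx-⟦⟧ {l = pos A} _ t = t
  addEx-⟦⟧ {l = neg A} _ t = t
  addEx-⟦⟧ {l = all S F₂} _ t = t
  addEx-⟦⟧ {R} {F₁} {exs S F₂} t∀ t with R ≟ S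
  ... | yes refl = let e , r , tF₂ = t in e , r , ⟦⟧-++⁺ F₁ (t∀ e r) tF₂
  ... | no _ = t

  a2-⊨ : ∀ {R F₁ G d} → ⟦ all R F₁ ⟧ˡ d → d ⊨ G → d ⊨ map (map (addEx R F₁)) G
  a2-⊨ t∀ [] = []
  a2-⊨ {R} {F₁} {d = d} t∀ (t ∷ ts) = Any⇒⟦⟧ᶜ (clause (⟦⟧ᶜ⇒Any t)) ∷ a2-⊨ t∀ ts
    where
    clause : ∀ {c} → Any (λ l → ⟦ l ⟧ˡ d) c → Any (λ l → ⟦ l ⟧ˡ d) (map (addEx R F₁) c)
    clause (here {x = l} t) = here (addEx-⟦⟧ {l = l} t∀ t)
    clause (there a) = there (clause a)

  TrueUnit : (Lit → Set) → Δ → Clause → Set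
  TrueUnit P d c = Σ Lit λ L → P L × L ∈ c × ⟦ L ⟧ˡ d × ClEq c (L ∷ [])

  data View (d : Δ) (F : ClauseSet) : Set where
    a1-view : ∀ {CL L} → CL ∈ F → L ∈ CL → ⟦ L ⟧ˡ d → ¬ ClEq CL (L ∷ []) → View d F
    a2-view : ∀ {CL R F₁} → AllUnit F → CL ∈ F → all R F₁ ∈ CL → ⟦ all R F₁ ⟧ˡ d → View d F
    a3-view : ∀ {CL R F₁} → AllUnitA3 F → CL ∈ F → exs R F₁ ∈ CL →
              ClEq CL (exs R F₁ ∷ []) → ⟦ exs R F₁ ⟧ˡ d → View d F
    atomic-view : All (TrueUnit Atom d) F → View d F

  non-unit-or-unit : ∀ {c d} → ⟦ c ⟧ᶜ d →
    (Σ Lit λ L → L ∈ c × ⟦ L ⟧ˡ d × ¬ ClEq c (L ∷ [])) ⊎ TrueUnit (λ _ → ⊤) d c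
  non-unit-or-unit {c} t with find (⟦⟧ᶜ⇒Any t)
  ... | L , L∈c , tL with ClEq? c (L ∷ [])
  ...   | yes u = inj₂ (L , tt , L∈c , tL , u)
  ...   | no ¬u = inj₁ (L , L∈c , tL , ¬u)

  forall-or-A3Form : ∀ {c d} → TrueUnit (λ _ → ⊤) d c →
    (∃₂ λ R F₁ → all R F₁ ∈ c × ⟦ all R F₁ ⟧ˡ d) ⊎ TrueUnit A3Form d c
  forall-or-A3Form (L , _ , L∈c , tL , u) with all-or-A3Form L
  ... | inj₁ (R , F₁ , refl) = inj₁ (R , F₁ , L∈c , tL)
  ... | inj₂ f = inj₂ (L , f , L∈c , tL , u)

  exists-or-Atom : ∀ {c d} → TrueUnit A3Form d c →
    (∃₂ λ R F₁ → exs R F₁ ∈ c × ClEq c (exs R F₁ ∷ []) × ⟦ exs R F₁ ⟧ˡ d) ⊎ TrueUnit Atom d c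
  exists-or-Atom (L , f , L∈c , tL , u) with exs-or-Atom f
  ... | inj₁ (R , F₁ , refl) = inj₁ (R , F₁ , L∈c , u , tL)
  ... | inj₂ atom = inj₂ (L , atom , L∈c , tL , u)

  -- three passes, because A2⁺ needs all clauses to be units and A3 needs all
  -- of them to be units of A, ¬A or ∃R.F literals
  view : ∀ {d F} → d ⊨ F → View d F
  view ts with any-or-all non-unit-or-unit ts
  ... | inj₁ any =
    let _ , CL∈F , _ , L∈CL , tL , non-unit = find any in a1-view CL∈F L∈CL tL non-unit
  ... | inj₂ units with any-or-all forall-or-A3Form units
  ...   | inj₁ any =
    let _ , CL∈F , _ , _ , a∈CL , t∀ = find any
    in a2-view (All.map (λ (L , _ , _ , _ , u) → L , u) units) CL∈F a∈CL t∀
  ...   | inj₂ units₃ with any-or-all exists-or-Atom units₃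
  ...     | inj₁ any =
    let _ , CL∈F , _ , _ , e∈CL , unit , t∃ = find any
    in a3-view (All.map (λ (L , f , _ , _ , u) → L , f , u) units₃) CL∈F e∈CL unit t∃
  ...     | inj₂ atoms = atomic-view atoms

  atomic-irreducible : ∀ {d F} → All (TrueUnit Atom d) F → Irreducible F
  atomic-irreducible {d} {F} units = no-A1 , no-A2 , no-A3
    where
    occurring-Atom : ∀ {CL L} → CL ∈ F → L ∈ CL → Atom L × ⟦ L ⟧ˡ d
    occurring-Atom CL∈F L∈CL with All.lookup units CL∈F
    ... | a , atom , _ , ta , CL⊆a , _ with SubCl-lookup CL⊆a L∈CL
    ...   | inj₁ e with LitEq-Atom atom e
    ...     | refl = atom , ta

    a1-fixes : ∀ {L c c'} → ⟦ L ⟧ˡ d → TrueUnit Atom d c → A1Clause L c c' → ClEq c c'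
    a1-fixes tL (a , atom , _ , ta , c≈a) (inj₁ (m , refl))
      with LitEq-Atom atom (MemL-All≡ m (SubCl-Atom atom (proj₁ c≈a)))
    ... | refl = c≈a
    a1-fixes {L} tL (a , atom , _ , ta , c≈a) (inj₂ (_ , r))
      rewrite Remove-none r (All.map (λ { refl e → comp-disjoint L (⟦⟧-LitEq e ta) tL })
                                     (SubCl-Atom atom (proj₁ c≈a)))
      = ClEq-refl _

    a1-fixes-all : ∀ {L G G'} → ⟦ L ⟧ˡ d → All (TrueUnit Atom d) G →
                   Pointwise (A1Clause L) G G' → Pointwise ClEq G G'
    a1-fixes-all tL [] [] = []
    a1-fixes-all tL (u ∷ us) (p ∷ ps) = a1-fixes tL u p ∷ a1-fixes-all tL us ps

    no-A1 : ∀ F' → ¬ A1 F F'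
    no-A1 F' (a1 L CL CL∈F L∈CL pw changed) =
      changed (Pointwise-ClEq⇒CSEq (a1-fixes-all (proj₂ (occurring-Atom CL∈F L∈CL)) units pw))

    no-A2 : ∀ F' → ¬ A2 F F'
    no-A2 F' (a2 R F₁ CL _ CL∈F a∈CL _ _ _) with occurring-Atom CL∈F a∈CL
    ... | () , _

    no-A3 : ∀ F' F₁ → ¬ A3 F F' F₁
    no-A3 F' F₁ (a3 R CL _ CL∈F e∈CL _) with occurring-Atom CL∈F e∈CL
    ... | () , _

  mutual
    saturate : ∀ {k F d} → Acc _<_ k → Acc _<_ (size F) → Depth≤ k F → d ⊨ F →
               ∀ xs ys → Saturation xs F ys
    saturate ak as bs ts = saturate-view ak as bs ts (view ts)

    saturate-view : ∀ {k F d} → Acc _<_ k → Acc _<_ (size F) → Depth≤ k F → d ⊨ F → View d F →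
                    ∀ xs ys → Saturation xs F ys
    saturate-view ak as bs ts (atomic-view atoms) xs ys =
      settled-saturation (atomic-irreducible atoms , ⊨⇒ClashFreeCS ts)
    saturate-view {F = F} ak (acc rs) bs ts (a1-view {CL} {L} CL∈F L∈CL tL non-unit) xs ys =
      let _ , pw = a1-clauses L F
      in stepA1 xs ys (a1 L CL CL∈F L∈CL pw (a1-changes pw CL∈F L∈CL non-unit))
           ◅ˢ saturate ak (rs (a1-size-< pw CL∈F L∈CL non-unit))
                (a1-depth pw (Depth≤-lookup bs CL∈F L∈CL) bs) (a1-⊨ tL pw ts) xs ys
    saturate-view {F = F} ak (acc rs) bs ts (a2-view {CL} {R} {F₁} units CL∈F a∈CL t∀) xs ys =
      let G , r = remove (λ c → MemL? (all R F₁) c) F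
          smaller = subst (_< size F) (sym (size-map (addEx R F₁) G))
                          (Remove-size-< r CL∈F (∈⇒MemL a∈CL))
      in stepA2 xs ys (a2 R F₁ CL units CL∈F a∈CL G r refl)
           ◅ˢ saturate ak (rs smaller) (a2-depth (Depth≤-lookup bs CL∈F a∈CL) (Remove-All r bs))
                (a2-⊨ t∀ (Remove-All r ts)) xs ys
    saturate-view {F = F} ak@(acc rk) (acc rs) bs ts
                  (a3-view {CL} {R} {F₁} units CL∈F e∈CL unit (e , _ , tF₁)) xs ys =
      let F' , r = remove (λ c → ClEq? c (exs R F₁ ∷ [])) F
          j , j<k , bF₁ = exs-depth (Depth≤-lookup bs CL∈F e∈CL)
          spawned = saturate (rk j<k) (<-wellFounded (size F₁)) bF₁ (⟦⟧ˢ⇒⊨ tF₁) (xs ++ F' ∷ ys) []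
      in spawn-saturation (stepA3 xs ys (a3 R CL units CL∈F e∈CL r)) spawned
           (saturate ak (rs (Remove-size-< r CL∈F unit)) (Remove-All r bs) (Remove-All r ts) xs _)

mainTheorem7 : (F : ClauseSet) → Satisfiable F →
    Σ Family (λ S → Derivation (F ∷ []) S × Complete S × ClashFree S)
mainTheorem7 F (I , d , tF) =
  let k , bF = depth F
      saturation der settled spawned =
        saturate (<-wellFounded k) (<-wellFounded (size F)) bF (⟦⟧ˢ⇒⊨ tF) [] []
  in _ , der , All-Settled⇒Complete (settled ∷ spawned) , All.map proj₂ (settled ∷ spawned)
  where open Semantics I
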